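{- Let $\Sigma_5=\{0,1,2,3,4\}$ and let $h:\Sigma_5^*\to\Sigma_5^*$ be the morphism $h(0)=012321012340121012321234$, $h(1)=012101234323401234321234$, $h(2)=012101232123401232101234$, $h(3)=012321234323401232101234$, $h(4)=012321234012101234321234$. If $w\in\Sigma_5^*$ is squarefree and contains none of the subwords $02,03,04,14,20,30,41$, then $h(w)$ is squarefree and contains none of the subwords $02,03,04,13,14,20,24,30,31,41,42,010,434$.
   Context: A square is a nonempty word $xx$; squarefree means containing no square as a (contiguous) subword. -}

module Defs where

open import Data.Fin using (Fin; zero; suc)
open import Data.List using (List; []; _∷_; _++_; concatMap)
open import Data.Product using (∃; ∃-syntax; _×_)
open import Data.Empty using (⊥)
open import Relation.Nullary using (¬_)
open import Relation.Binary.PropositionalEquality using (_≡_; _≢_)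

Σ₅ : Set
Σ₅ = Fin 5

Word : Set
Word = List Σ₅

a0 a1 a2 a3 a4 : Σ₅
a0 = zero
a1 = suc zero
a2 = suc (suc zero)
a3 = suc (suc (suc zero))
a4 = suc (suc (suc (suc zero)))

_isSubwordOf_ : Word → Word → Set
x isSubwordOf w = ∃[ u ] ∃[ v ] (w ≡ u ++ x ++ v)

IsSquare : Word → Set
IsSquare s = ∃[ x ] (x ≢ [] × s ≡ x ++ x)

SquareFree : Word → Set
SquareFree w = ∀ s → IsSquare s → ¬ (s isSubwordOf w)

data AvoidsAll (w : Word) : List Word → Set where
  []  : AvoidsAll w []
  _∷_ : ∀ {x xs} → ¬ (x isSubwordOf w) → AvoidsAll w xs → AvoidsAll w (x ∷ xs)

hLetter : Σ₅ → Word
hLetter zero = a0 ∷ a1 ∷ a2 ∷ a3 ∷ a2 ∷ a1 ∷ a0 ∷ a1 ∷ a2 ∷ a3 ∷ a4 ∷ a0 ∷ a1 ∷ a2 ∷ a1 ∷ a0 ∷ a1 ∷ a2 ∷ a3 ∷ a2 ∷ a1 ∷ a2 ∷ a3 ∷ a4 ∷ []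
hLetter (suc zero) = a0 ∷ a1 ∷ a2 ∷ a1 ∷ a0 ∷ a1 ∷ a2 ∷ a3 ∷ a4 ∷ a3 ∷ a2 ∷ a3 ∷ a4 ∷ a0 ∷ a1 ∷ a2 ∷ a3 ∷ a4 ∷ a3 ∷ a2 ∷ a1 ∷ a2 ∷ a3 ∷ a4 ∷ []
hLetter (suc (suc zero)) = a0 ∷ a1 ∷ a2 ∷ a1 ∷ a0 ∷ a1 ∷ a2 ∷ a3 ∷ a2 ∷ a1 ∷ a2 ∷ a3 ∷ a4 ∷ a0 ∷ a1 ∷ a2 ∷ a3 ∷ a2 ∷ a1 ∷ a0 ∷ a1 ∷ a2 ∷ a3 ∷ a4 ∷ []
hLetter (suc (suc (suc zero))) = a0 ∷ a1 ∷ a2 ∷ a3 ∷ a2 ∷ a1 ∷ a2 ∷ a3 ∷ a4 ∷ a3 ∷ a2 ∷ a3 ∷ a4 ∷ a0 ∷ a1 ∷ a2 ∷ a3 ∷ a2 ∷ a1 ∷ a0 ∷ a1 ∷ a2 ∷ a3 ∷ a4 ∷ []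
hLetter (suc (suc (suc (suc zero)))) = a0 ∷ a1 ∷ a2 ∷ a3 ∷ a2 ∷ a1 ∷ a2 ∷ a3 ∷ a4 ∷ a0 ∷ a1 ∷ a2 ∷ a1 ∷ a0 ∷ a1 ∷ a2 ∷ a3 ∷ a4 ∷ a3 ∷ a2 ∷ a1 ∷ a2 ∷ a3 ∷ a4 ∷ []

h : Word → Word
h = concatMap hLetter

forbiddenIn : List Word
forbiddenIn =
  (a0 ∷ a2 ∷ []) ∷ (a0 ∷ a3 ∷ []) ∷ (a0 ∷ a4 ∷ []) ∷ (a1 ∷ a4 ∷ []) ∷
  (a2 ∷ a0 ∷ []) ∷ (a3 ∷ a0 ∷ []) ∷ (a4 ∷ a1 ∷ []) ∷ []

forbiddenOut : List Word
forbiddenOut =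
  (a0 ∷ a2 ∷ []) ∷ (a0 ∷ a3 ∷ []) ∷ (a0 ∷ a4 ∷ []) ∷ (a1 ∷ a3 ∷ []) ∷
  (a1 ∷ a4 ∷ []) ∷ (a2 ∷ a0 ∷ []) ∷ (a2 ∷ a4 ∷ []) ∷ (a3 ∷ a0 ∷ []) ∷
  (a3 ∷ a1 ∷ []) ∷ (a4 ∷ a1 ∷ []) ∷ (a4 ∷ a2 ∷ []) ∷
  (a0 ∷ a1 ∷ a0 ∷ []) ∷ (a4 ∷ a3 ∷ a4 ∷ []) ∷ []

-- The morphism h is 24-uniform and admissible words (no squares of letters and
-- none of the input factors) only use 13 of the 25 letter pairs. Every occurrence of a factor
-- in h(w) starts in one of the 24 positions of some block h(a), so squares and forbidden
-- factors can be located inside h(y) at an offset r < 24, for y a suffix of w. Forbidden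
-- factors and squares of period at most 51 then fit into h of an admissible word of length
-- at most 6, where they are excluded by exhaustive evaluation, except for periods 24 and 48.
-- A longer square contains a full block followed by four letters; these 28 letters only occur
-- at block boundaries, which forces the period to be a multiple of 24. Finally, the images of
-- letters cannot be spliced from a suffix of one image and a prefix of another, so a square
-- whose period is a multiple of 24 lifts to a square of w.
module Submission where

open import Defs
open import Data.Bool using (Bool; true; false; _∧_; _∨_; not)
open import Data.Empty using (⊥; ⊥-elim)
open import Data.Fin using (zero; suc; _≟_)
open import Data.Bool.ListAction using (all)
open import Data.List using (List; []; _∷_; _++_; length; take; drop; concatMap)
open import Data.List.Properties
  using ( ≡-dec; length-++; length-drop; length-take; ++-assoc; ++-identityʳ; ∷-injectiveˡ; ∷-injectiveʳ
        ; take++drop≡id; drop-drop; take-drop; take-take; take-[]; drop-[]; concatMap-++)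
open import Data.List.Membership.Propositional using (_∈_; _∉_)
open import Data.List.Relation.Unary.Any using (here; there)
open import Data.List.Relation.Unary.Linked using (Linked; []; [-]; _∷_)
open import Data.Nat using (ℕ; zero; suc; _+_; _*_; _∸_; _⊓_; _%_; _/_; _≤_; _<_; _≤?_; _≡ᵇ_; z≤n; s≤s; NonZero)
open import Data.Nat.Base using (>-nonZero⁻¹)
open import Data.Nat.DivMod using (m≡m%n+[m/n]*n; m%n<n)
open import Data.Nat.Divisibility using (_∣_; divides; _∣?_; ∣-refl; ∣m+n∣m⇒∣n; m%n≡0⇒n∣m)
open import Data.Nat.Properties
  using ( suc-injective; +-comm; +-assoc; +-identityʳ; +-suc; *-distribʳ-+; *-cancelʳ-≡; *-cancelʳ-≤; +-cancelˡ-≤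
        ; +-monoʳ-≤; +-monoˡ-≤; +-mono-≤; m≤m+n; m≤n+m; m∸n≤m; m+[n∸m]≡n; m∸n+n≡m; m≤n⇒m⊓n≡m; m⊓n≤m; m+n≤o⇒m≤o
        ; ≤-trans; ≤-pred; <⇒≤; ≰⇒>; m<1+n⇒m<n∨m≡n; module ≤-Reasoning)
open import Data.Product using (∃-syntax; _×_; _,_; proj₁; proj₂)
open import Data.Sum as Sum using (_⊎_; inj₁; inj₂)
open import Function.Base using (_∘_)
open import Relation.Binary.Definitions using (DecidableEquality)
open import Relation.Binary.PropositionalEquality
open import Relation.Nullary using (¬_; Dec; yes; no; does; ¬?)
open import Relation.Nullary.Decidable using (_×-dec_; dec-true)

private variable
  A : Set

take-++ˡ : ∀ n (xs ys : List A) → n ≤ length xs → take n (xs ++ ys) ≡ take n xs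
take-++ˡ zero    xs       ys _         = refl
take-++ˡ (suc n) (x ∷ xs) ys (s≤s n≤) = cong (x ∷_) (take-++ˡ n xs ys n≤)

drop-++ˡ : ∀ n (xs ys : List A) → n ≤ length xs → drop n (xs ++ ys) ≡ drop n xs ++ ys
drop-++ˡ zero    xs       ys _         = refl
drop-++ˡ (suc n) (x ∷ xs) ys (s≤s n≤) = drop-++ˡ n xs ys n≤

take-++ʳ : ∀ (xs : List A) n ys → take (length xs + n) (xs ++ ys) ≡ xs ++ take n ys
take-++ʳ []       n ys = refl
take-++ʳ (x ∷ xs) n ys = cong (x ∷_) (take-++ʳ xs n ys)

drop-++ʳ : ∀ (xs : List A) n ys → drop (length xs + n) (xs ++ ys) ≡ drop n ys
drop-++ʳ []       n ys = refl
drop-++ʳ (x ∷ xs) n ys = drop-++ʳ xs n ys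

take-length-++ : ∀ (xs ys : List A) → take (length xs) (xs ++ ys) ≡ xs
take-length-++ []       ys = refl
take-length-++ (x ∷ xs) ys = cong (x ∷_) (take-length-++ xs ys)

drop-length-++ : ∀ (xs ys : List A) → drop (length xs) (xs ++ ys) ≡ ys
drop-length-++ []       ys = refl
drop-length-++ (x ∷ xs) ys = drop-length-++ xs ys

length-take-≤ : ∀ k (xs : List A) → length (take k xs) ≤ k
length-take-≤ k xs = subst (_≤ k) (sym (length-take k xs)) (m⊓n≤m k (length xs))

take-square : ∀ (x v : List A) → take (length x + length x) (x ++ x ++ v) ≡ x ++ x
take-square x v = trans (cong₂ take (sym (length-++ x)) (sym (++-assoc x x v))) (take-length-++ (x ++ x) v)

++-cancel-length : ∀ (xs ys zs ws : List A) → length xs ≡ length zs →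
                   xs ++ ys ≡ zs ++ ws → xs ≡ zs × ys ≡ ws
++-cancel-length []       ys []       ws _   eq = refl , eq
++-cancel-length (x ∷ xs) ys (z ∷ zs) ws len eq
  with refl ← ∷-injectiveˡ eq
  with refl , ys≡ws ← ++-cancel-length xs ys zs ws (suc-injective len) (∷-injectiveʳ eq)
  = refl , ys≡ws

take-drop-++ˡ : ∀ j n (xs ys : List A) → j + n ≤ length xs →
                take n (drop j (xs ++ ys)) ≡ take n (drop j xs)
take-drop-++ˡ zero    n xs       ys le       = take-++ˡ n xs ys le
take-drop-++ˡ (suc j) n (x ∷ xs) ys (s≤s le) = take-drop-++ˡ j n xs ys le

square⇒periodic : ∀ {i p n} (s x v : List A) → drop i s ≡ x ++ x ++ v →
                  i ≤ p → p + n ≤ i + length x →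
                  take n (drop p s) ≡ take n (drop (p + length x) s)
square⇒periodic {i = i} {p} {n} s x v eq i≤p p+n≤ = begin
  take n (drop p s)                          ≡⟨ cong (λ k → take n (drop k s)) (sym p≡i+j) ⟩
  take n (drop (i + j) s)                    ≡⟨ cong (take n) (sym (drop-drop i j s)) ⟩
  take n (drop j (drop i s))                 ≡⟨ cong (λ t → take n (drop j t)) eq ⟩
  take n (drop j (x ++ x ++ v))              ≡⟨ take-drop-++ˡ j n x (x ++ v) j+n≤ ⟩
  take n (drop j x)                          ≡⟨ take-drop-++ˡ j n x v j+n≤ ⟨
  take n (drop j (x ++ v))                   ≡⟨ cong (take n) (drop-++ʳ x j (x ++ v)) ⟨
  take n (drop (length x + j) (x ++ x ++ v)) ≡⟨ cong (λ t → take n (drop (length x + j) t)) eq ⟨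
  take n (drop (length x + j) (drop i s))    ≡⟨ cong (take n) (drop-drop i (length x + j) s) ⟩
  take n (drop (i + (length x + j)) s)       ≡⟨ cong (λ k → take n (drop k s)) shifted ⟩
  take n (drop (p + length x) s)             ∎
  where
  open ≡-Reasoning
  j : ℕ
  j = p ∸ i
  p≡i+j : i + j ≡ p
  p≡i+j = m+[n∸m]≡n i≤p
  j+n≤ : j + n ≤ length x
  j+n≤ = +-cancelˡ-≤ i _ _ (subst (_≤ i + length x) (trans (cong (_+ n) (sym p≡i+j)) (+-assoc i j n)) p+n≤)
  shifted : i + (length x + j) ≡ p + length x
  shifted = trans (cong (i +_) (+-comm (length x) j)) (trans (sym (+-assoc i j (length x))) (cong (_+ length x) p≡i+j))

splitAt-length : ∀ n (y : List A) → n ≤ length y → ∃[ U ] ∃[ rest ] (y ≡ U ++ rest × length U ≡ n)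
splitAt-length zero    y       _ = [] , y , refl , refl
splitAt-length (suc n) (a ∷ y) (s≤s n≤)
  with U , rest , refl , refl ← splitAt-length n y n≤ = a ∷ U , rest , refl , refl

square-length : ∀ {r : ℕ} (s x v : List A) → drop r s ≡ x ++ x ++ v → length x + length x ≤ length s
square-length {r = r} s x v eq = begin
  length x + length x              ≤⟨ +-monoʳ-≤ (length x) (m≤m+n (length x) (length v)) ⟩
  length x + (length x + length v) ≡⟨ trans (length-++ x) (cong (length x +_) (length-++ x)) ⟨
  length (x ++ x ++ v)             ≡⟨ trans (sym (length-drop r s)) (cong length eq) ⟨
  length s ∸ r                     ≤⟨ m∸n≤m (length s) r ⟩
  length s                         ∎
  where open ≤-Reasoning

HasSquare : List A → Set
HasSquare y = ∃[ z ] (z ≢ [] × ∃[ u ] ∃[ v ] (y ≡ u ++ (z ++ z) ++ v))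

square-at-start : ∀ (b : A) u rest → HasSquare (b ∷ u ++ b ∷ u ++ rest)
square-at-start b u rest = b ∷ u , (λ ()) , [] , rest , sym (++-assoc (b ∷ u) (b ∷ u) rest)

square-after-letter : ∀ (b : A) u c rest → HasSquare (b ∷ u ++ c ∷ u ++ c ∷ rest)
square-after-letter b u c rest = u ++ c ∷ [] , nonempty u , b ∷ [] , rest , cong (b ∷_) (begin
  u ++ c ∷ u ++ c ∷ rest                       ≡⟨ ++-assoc u (c ∷ []) (u ++ c ∷ rest) ⟨
  (u ++ c ∷ []) ++ u ++ c ∷ rest               ≡⟨ cong ((u ++ c ∷ []) ++_) (++-assoc u (c ∷ []) rest) ⟨
  (u ++ c ∷ []) ++ (u ++ c ∷ []) ++ rest       ≡⟨ ++-assoc (u ++ c ∷ []) (u ++ c ∷ []) rest ⟨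
  ((u ++ c ∷ []) ++ (u ++ c ∷ [])) ++ rest     ∎)
  where
  open ≡-Reasoning
  nonempty : ∀ u → u ++ c ∷ [] ≢ []
  nonempty []      ()
  nonempty (_ ∷ _) ()

module UniformMorphism (f : A → List A) {L : ℕ} .{{_ : NonZero L}} (length-f : ∀ a → length (f a) ≡ L) where

  F : List A → List A
  F = concatMap f

  length-F : ∀ y → length (F y) ≡ length y * L
  length-F []      = refl
  length-F (a ∷ y) = trans (length-++ (f a)) (cong₂ _+_ (length-f a) (length-F y))

  drop-F : ∀ q y → drop (q * L) (F y) ≡ F (drop q y)
  drop-F zero    y       = refl
  drop-F (suc q) []      = drop-[] (suc q * L)
  drop-F (suc q) (a ∷ y) = trans
    (subst (λ l → drop (l + q * L) (f a ++ F y) ≡ drop (q * L) (F y)) (length-f a) (drop-++ʳ (f a) (q * L) (F y)))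
    (drop-F q y)

  take-F : ∀ q y → take (q * L) (F y) ≡ F (take q y)
  take-F zero    y       = refl
  take-F (suc q) []      = take-[] (suc q * L)
  take-F (suc q) (a ∷ y) = trans
    (subst (λ l → take (l + q * L) (f a ++ F y) ≡ f a ++ take (q * L) (F y)) (length-f a) (take-++ʳ (f a) (q * L) (F y)))
    (cong (f a ++_) (take-F q y))

  drop-F-blocks : ∀ q r y → drop (q * L + r) (F y) ≡ drop r (F (drop q y))
  drop-F-blocks q r y = trans (sym (drop-drop (q * L) r (F y))) (cong (drop r) (drop-F q y))

  take-drop-F : ∀ k r n y → r + n ≤ k * L → take n (drop r (F y)) ≡ take n (drop r (F (take k y)))
  take-drop-F k r n y r+n≤ = begin
    take n (drop r (F y))                       ≡⟨ take-drop n r (F y) ⟩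
    drop r (take (r + n) (F y))                 ≡⟨ cong (λ m → drop r (take m (F y))) (m≤n⇒m⊓n≡m r+n≤) ⟨
    drop r (take ((r + n) ⊓ (k * L)) (F y))     ≡⟨ cong (drop r) (take-take (r + n) (k * L) (F y)) ⟨
    drop r (take (r + n) (take (k * L) (F y)))  ≡⟨ cong (λ t → drop r (take (r + n) t)) (take-F k y) ⟩
    drop r (take (r + n) (F (take k y)))        ≡⟨ take-drop n r (F (take k y)) ⟨
    take n (drop r (F (take k y)))              ∎
    where open ≡-Reasoning

  F-injective : (∀ {a b} → f a ≡ f b → a ≡ b) → ∀ {u u'} → F u ≡ F u' → u ≡ u'
  F-injective f-inj {u} {u'} eq = go u u' (*-cancelʳ-≡ _ _ L (trans (sym (length-F u)) (trans (cong length eq) (length-F u')))) eq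
    where
    go : ∀ u u' → length u ≡ length u' → F u ≡ F u' → u ≡ u'
    go []      []       _   _  = refl
    go (a ∷ u) (b ∷ u') len eq
      with fa≡fb , Fu≡Fu' ← ++-cancel-length (f a) (F u) (f b) (F u') (trans (length-f a) (sym (length-f b))) eq
      = cong₂ _∷_ (f-inj fa≡fb) (go u u' (suc-injective len) Fu≡Fu')

  drop-F-mod : ∀ i y → drop i (F y) ≡ drop (i % L) (F (drop (i / L) y))
  drop-F-mod i y = trans (cong (λ k → drop k (F y)) (trans (m≡m%n+[m/n]*n i L) (+-comm (i % L) _)))
                         (drop-F-blocks (i / L) (i % L) y)

  SpliceRigid : Set
  SpliceRigid = ∀ {r b c e} → r < L → drop r (f b) ≡ drop r (f c) → take r (f c) ≡ take r (f e) → b ≡ c ⊎ c ≡ e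

  SpliceRigid⇒injective : SpliceRigid → ∀ {a b} → f a ≡ f b → a ≡ b
  SpliceRigid⇒injective rigid {a} {b} fa≡fb with rigid {e = a} (>-nonZero⁻¹ L) fa≡fb refl
  ... | inj₁ a≡b = a≡b
  ... | inj₂ b≡a = sym b≡a

  read-window : ∀ {r b u z x w} → r ≤ L → drop r (F (b ∷ u ++ z)) ≡ x ++ w → length x ≡ suc (length u) * L →
                x ≡ drop r (f b) ++ F u ++ take r (F z) × w ≡ drop r (F z)
  read-window {r} {b} {u} {z} {x} {w} r≤L eq len-x = from-take , from-drop
    where
    P : List A
    P = drop r (f b) ++ F u
    split : x ++ w ≡ P ++ F z
    split = begin
      x ++ w                           ≡⟨ eq ⟨
      drop r (f b ++ F (u ++ z))       ≡⟨ drop-++ˡ r (f b) (F (u ++ z)) (subst (r ≤_) (sym (length-f b)) r≤L) ⟩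
      drop r (f b) ++ F (u ++ z)       ≡⟨ cong (drop r (f b) ++_) (concatMap-++ f u z) ⟩
      drop r (f b) ++ F u ++ F z       ≡⟨ ++-assoc (drop r (f b)) (F u) (F z) ⟨
      P ++ F z                         ∎
      where open ≡-Reasoning
    len : length x ≡ length P + r
    len = sym (begin
      length P + r                             ≡⟨ cong (_+ r) (length-++ (drop r (f b))) ⟩
      length (drop r (f b)) + length (F u) + r ≡⟨ cong₂ (λ a c → a + c + r) (length-drop r (f b)) (length-F u) ⟩
      length (f b) ∸ r + length u * L + r      ≡⟨ cong (λ l → l ∸ r + length u * L + r) (length-f b) ⟩
      L ∸ r + length u * L + r                 ≡⟨ +-assoc (L ∸ r) _ r ⟩
      L ∸ r + (length u * L + r)               ≡⟨ cong (L ∸ r +_) (+-comm _ r) ⟩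
      L ∸ r + (r + length u * L)               ≡⟨ +-assoc (L ∸ r) r _ ⟨
      L ∸ r + r + length u * L                 ≡⟨ cong (_+ length u * L) (m∸n+n≡m r≤L) ⟩
      L + length u * L                         ≡⟨ len-x ⟨
      length x                                 ∎)
      where open ≡-Reasoning
    from-take : x ≡ drop r (f b) ++ F u ++ take r (F z)
    from-take = begin
      x                              ≡⟨ take-length-++ x w ⟨
      take (length x) (x ++ w)       ≡⟨ cong₂ take len split ⟩
      take (length P + r) (P ++ F z) ≡⟨ take-++ʳ P r (F z) ⟩
      P ++ take r (F z)              ≡⟨ ++-assoc (drop r (f b)) (F u) _ ⟩
      drop r (f b) ++ F u ++ take r (F z) ∎
      where open ≡-Reasoning
    from-drop : w ≡ drop r (F z)
    from-drop = trans (sym (drop-length-++ x w)) (trans (cong₂ drop len split) (drop-++ʳ P r (F z)))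

  square-spans-two-blocks : ∀ {r k} y x v → drop r (F y) ≡ x ++ x ++ v → length x ≡ suc k * L →
                            ∃[ b ] ∃[ u ] ∃[ c ] ∃[ u' ] ∃[ rest ] (y ≡ b ∷ u ++ c ∷ u' ++ rest × length u ≡ k × length u' ≡ k)
  square-spans-two-blocks {r} {k} y x v eq len-x = split y 2m≤y
    where
    m : ℕ
    m = suc k
    2m≤y : m + m ≤ length y
    2m≤y = *-cancelʳ-≤ _ _ L (begin
      (m + m) * L           ≡⟨ *-distribʳ-+ L m m ⟩
      m * L + m * L         ≡⟨ cong₂ _+_ len-x len-x ⟨
      length x + length x   ≤⟨ square-length {r = r} (F y) x v eq ⟩
      length (F y)          ≡⟨ length-F y ⟩
      length y * L          ∎)
      where open ≤-Reasoning
    split : ∀ y → m + m ≤ length y →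
            ∃[ b ] ∃[ u ] ∃[ c ] ∃[ u' ] ∃[ rest ] (y ≡ b ∷ u ++ c ∷ u' ++ rest × length u ≡ k × length u' ≡ k)
    split y 2m≤y
      with b ∷ u , y₁ , refl , len-bu ← splitAt-length m y (m+n≤o⇒m≤o m 2m≤y)
      with c ∷ u' , rest , refl , len-cu' ← splitAt-length m y₁
             (+-cancelˡ-≤ m _ _ (subst (m + m ≤_) (trans (length-++ (b ∷ u)) (cong (_+ length y₁) len-bu)) 2m≤y))
      = b , u , c , u' , rest , refl , suc-injective len-bu , suc-injective len-cu'

  square-halves : ∀ {r b u c u' rest x v} → r ≤ L → drop r (F (b ∷ u ++ c ∷ u' ++ rest)) ≡ x ++ x ++ v →
                  length x ≡ suc (length u) * L → length u ≡ length u' →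
                  drop r (f b) ≡ drop r (f c) × F u ≡ F u' × take r (f c) ≡ take r (F rest)
  square-halves {r} {b} {u} {c} {u'} {rest} {x} {v} r≤L eq len-x len-u =
    proj₁ boundary , proj₁ interior , proj₂ interior
    where
    first : x ≡ drop r (f b) ++ F u ++ take r (F (c ∷ u' ++ rest)) × x ++ v ≡ drop r (F (c ∷ u' ++ rest))
    first = read-window {b = b} {u} {c ∷ u' ++ rest} r≤L eq len-x
    second : x ≡ drop r (f c) ++ F u' ++ take r (F rest)
    second = proj₁ (read-window {b = c} {u'} {rest} r≤L (sym (proj₂ first)) (subst (λ l → length x ≡ suc l * L) len-u len-x))
    readings : drop r (f b) ++ F u ++ take r (f c) ≡ drop r (f c) ++ F u' ++ take r (F rest)
    readings = begin
      drop r (f b) ++ F u ++ take r (f c)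
        ≡⟨ cong (λ t → drop r (f b) ++ F u ++ t) (take-++ˡ r (f c) _ (subst (r ≤_) (sym (length-f c)) r≤L)) ⟨
      drop r (f b) ++ F u ++ take r (F (c ∷ u' ++ rest)) ≡⟨ trans (sym (proj₁ first)) second ⟩
      drop r (f c) ++ F u' ++ take r (F rest)            ∎
      where open ≡-Reasoning
    boundary : drop r (f b) ≡ drop r (f c) × F u ++ take r (f c) ≡ F u' ++ take r (F rest)
    boundary = ++-cancel-length (drop r (f b)) _ (drop r (f c)) _
                 (trans (length-drop r (f b)) (trans (cong (_∸ r) (trans (length-f b) (sym (length-f c)))) (sym (length-drop r (f c)))))
                 readings
    interior : F u ≡ F u' × take r (f c) ≡ take r (F rest)
    interior = ++-cancel-length (F u) _ (F u') _ (trans (length-F u) (trans (cong (_* L) len-u) (sym (length-F u')))) (proj₂ boundary)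

  period-extends : SpliceRigid → ∀ {r b c} rest → r < L → drop r (f b) ≡ drop r (f c) → take r (f c) ≡ take r (F rest) →
                   b ≡ c ⊎ ∃[ rest' ] (rest ≡ c ∷ rest')
  period-extends rigid {r} {b} {c} [] r<L db≡dc tc≡[] =
    inj₁ (SpliceRigid⇒injective rigid (subst (λ n → drop n (f b) ≡ drop n (f c)) r≡0 db≡dc))
    where
    r≡0 : r ≡ 0
    r≡0 = trans (sym (m≤n⇒m⊓n≡m (subst (r ≤_) (sym (length-f c)) (<⇒≤ r<L))))
                (trans (sym (length-take r (f c))) (cong length (trans tc≡[] (take-[] r))))
  period-extends rigid {r} (e ∷ rest') r<L db≡dc tc≡te
    with rigid r<L db≡dc (trans tc≡te (take-++ˡ r (f e) _ (subst (r ≤_) (sym (length-f e)) (<⇒≤ r<L))))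
  ... | inj₁ b≡c = inj₁ b≡c
  ... | inj₂ c≡e = inj₂ (rest' , cong (_∷ rest') (sym c≡e))

  square-of-multiple-period : SpliceRigid → ∀ {r k} y x v → r < L → drop r (F y) ≡ x ++ x ++ v →
                              length x ≡ suc k * L → HasSquare y
  square-of-multiple-period rigid {r} {k} y x v r<L eq len-x
    with b , u , c , u' , rest , refl , refl , len-u' ← square-spans-two-blocks {r} {k} y x v eq len-x
    with db≡dc , Fu≡Fu' , tc≡tr ← square-halves {r} {b} {u} {c} {u'} {rest} {x} {v} (<⇒≤ r<L) eq len-x (sym len-u')
    with refl ← F-injective (SpliceRigid⇒injective rigid) {u} {u'} Fu≡Fu'
    with period-extends rigid {r} {b} {c} rest r<L db≡dc tc≡tr
  ... | inj₁ refl             = square-at-start b u rest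
  ... | inj₂ (rest' , refl)   = square-after-letter b u c rest'

  locate : ∀ w u x → F w ≡ u ++ x → drop (length u % L) (F (drop (length u / L) w)) ≡ x
  locate w u x eq = trans (sym (drop-F-mod (length u) w)) (trans (cong (drop (length u)) eq) (drop-length-++ u x))

_≟ʷ_ : DecidableEquality Word
_≟ʷ_ = ≡-dec _≟_

open import Data.List.Membership.DecPropositional _≟ʷ_ using (_∉?_)

hLetter-length : ∀ a → length (hLetter a) ≡ 24
hLetter-length zero                         = refl
hLetter-length (suc zero)                   = refl
hLetter-length (suc (suc zero))             = refl
hLetter-length (suc (suc (suc zero)))       = refl
hLetter-length (suc (suc (suc (suc zero)))) = refl

open UniformMorphism hLetter hLetter-length

isSubwordOf-trans : ∀ {x y w} → x isSubwordOf y → y isSubwordOf w → x isSubwordOf w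
isSubwordOf-trans {x} (u₁ , v₁ , refl) (u₂ , v₂ , refl) =
  u₂ ++ u₁ , v₁ ++ v₂ , (begin
    u₂ ++ (u₁ ++ x ++ v₁) ++ v₂ ≡⟨ cong (u₂ ++_) (++-assoc u₁ (x ++ v₁) v₂) ⟩
    u₂ ++ u₁ ++ (x ++ v₁) ++ v₂ ≡⟨ cong (λ t → u₂ ++ u₁ ++ t) (++-assoc x v₁ v₂) ⟩
    u₂ ++ u₁ ++ x ++ v₁ ++ v₂   ≡⟨ ++-assoc u₂ u₁ _ ⟨
    (u₂ ++ u₁) ++ x ++ v₁ ++ v₂ ∎)
  where open ≡-Reasoning

take-isSubwordOf : ∀ k w → take k w isSubwordOf w
take-isSubwordOf k w = [] , drop k w , sym (take++drop≡id k w)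

drop-isSubwordOf : ∀ k w → drop k w isSubwordOf w
drop-isSubwordOf k w = take k w , [] , trans (sym (take++drop≡id k w)) (cong (take k w ++_) (sym (++-identityʳ (drop k w))))

SquareFree-sub : ∀ {y w} → y isSubwordOf w → SquareFree w → SquareFree y
SquareFree-sub y⊑w sf s sq s⊑y = sf s sq (isSubwordOf-trans s⊑y y⊑w)

HasSquare⇒¬SquareFree : ∀ {y} → HasSquare y → ¬ SquareFree y
HasSquare⇒¬SquareFree (z , z≢[] , u , v , eq) sf = sf (z ++ z) (z , z≢[] , refl) (u , v , eq)

AvoidsAll-∈ : ∀ {w fs f} → AvoidsAll w fs → f ∈ fs → ¬ f isSubwordOf w
AvoidsAll-∈ (f∉ ∷ _)   (here refl) = f∉
AvoidsAll-∈ (_ ∷ avoid) (there f∈)  = AvoidsAll-∈ avoid f∈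

AvoidsAll-intro : ∀ {w} fs → (∀ {f} → f ∈ fs → ¬ f isSubwordOf w) → AvoidsAll w fs
AvoidsAll-intro []       _     = []
AvoidsAll-intro (f ∷ fs) avoid = avoid (here refl) ∷ AvoidsAll-intro fs (avoid ∘ there)

Allowed : Σ₅ → Σ₅ → Set
Allowed a b = a ≢ b × (a ∷ b ∷ []) ∉ forbiddenIn

allowed? : ∀ a b → Dec (Allowed a b)
allowed? a b = ¬? (a ≟ b) ×-dec ((a ∷ b ∷ []) ∉? forbiddenIn)

Admissible : Word → Set
Admissible w = ∀ {a b} → (a ∷ b ∷ []) isSubwordOf w → Allowed a b

admissible : ∀ {w} → SquareFree w → AvoidsAll w forbiddenIn → Admissible w
admissible sf avoid {a} ab⊑w = (λ { refl → sf (a ∷ a ∷ []) (a ∷ [] , (λ ()) , refl) ab⊑w })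
                             , (λ ab∈ → AvoidsAll-∈ avoid ab∈ ab⊑w)

Admissible-sub : ∀ {y w} → y isSubwordOf w → Admissible w → Admissible y
Admissible-sub y⊑w adm ab⊑y = adm (isSubwordOf-trans ab⊑y y⊑w)

Admissible⇒Linked : ∀ {w} → Admissible w → Linked Allowed w
Admissible⇒Linked {[]}          adm = []
Admissible⇒Linked {a ∷ []}      adm = [-]
Admissible⇒Linked {a ∷ b ∷ w}   adm =
  adm ([] , w , refl) ∷ Admissible⇒Linked (Admissible-sub (a ∷ [] , [] , cong (a ∷_) (sym (++-identityʳ (b ∷ w)))) adm)


∧-split : ∀ x {y} → x ∧ y ≡ true → x ≡ true × y ≡ true
∧-split true eq = refl , eq

∧-join : ∀ {x y} → x ≡ true → y ≡ true → x ∧ y ≡ true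
∧-join refl eq = eq

∨-split : ∀ x {y} → x ∨ y ≡ true → x ≡ true ⊎ y ≡ true
∨-split true  _  = inj₁ refl
∨-split false eq = inj₂ eq

⇒-elim : ∀ {x y} → not x ∨ y ≡ true → x ≡ true → y ≡ true
⇒-elim eq refl = eq

does-sound : ∀ {P : Set} (P? : Dec P) → does P? ≡ true → P
does-sound (yes p) _ = p

not-does-sound : ∀ {P : Set} (P? : Dec P) → not (does P?) ≡ true → ¬ P
not-does-sound (no ¬p) _ = ¬p

allΣ₅ : (Σ₅ → Bool) → Bool
allΣ₅ p = p a0 ∧ p a1 ∧ p a2 ∧ p a3 ∧ p a4

allΣ₅-sound : ∀ p → allΣ₅ p ≡ true → ∀ a → p a ≡ true
allΣ₅-sound p ok a with ∧-split (p a0) ok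
... | ok0 , ok′ with ∧-split (p a1) ok′
... | ok1 , ok″ with ∧-split (p a2) ok″
... | ok2 , ok‴ with ∧-split (p a3) ok‴
... | ok3 , ok4 with a
... | zero                       = ok0
... | suc zero                   = ok1
... | suc (suc zero)             = ok2
... | suc (suc (suc zero))       = ok3
... | suc (suc (suc (suc zero))) = ok4

allBelow : ℕ → (ℕ → Bool) → Bool
allBelow zero    p = true
allBelow (suc n) p = p n ∧ allBelow n p

allBelow-sound : ∀ n p {i} → allBelow n p ≡ true → i < n → p i ≡ true
allBelow-sound (suc n) p ok i<1+n with ∧-split (p n) ok | m<1+n⇒m<n∨m≡n i<1+n
... | _   , ok′ | inj₁ i<n  = allBelow-sound n p ok′ i<n
... | okn , _   | inj₂ refl = okn

all-sound : ∀ (p : A → Bool) {xs x} → all p xs ≡ true → x ∈ xs → p x ≡ true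
all-sound p {y ∷ _} ok (here refl) = proj₁ (∧-split (p y) ok)
all-sound p {y ∷ _} ok (there x∈)  = all-sound p (proj₂ (∧-split (p y) ok)) x∈

allLinkedFrom : ℕ → Σ₅ → (Word → Bool) → Bool
allLinkedFrom zero    a p = p (a ∷ [])
allLinkedFrom (suc k) a p = p (a ∷ []) ∧ allΣ₅ (λ b → not (does (allowed? a b)) ∨ allLinkedFrom k b (λ z → p (a ∷ z)))

allLinked : ℕ → (Word → Bool) → Bool
allLinked zero    p = p []
allLinked (suc k) p = p [] ∧ allΣ₅ (λ a → allLinkedFrom k a p)

allLinkedFrom-sound : ∀ k a p {z} → allLinkedFrom k a p ≡ true → length z ≤ k → Linked Allowed (a ∷ z) → p (a ∷ z) ≡ true
allLinkedFrom-sound zero    a p {[]}    ok _ _ = ok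
allLinkedFrom-sound (suc k) a p {[]}    ok _ _ = proj₁ (∧-split (p (a ∷ [])) ok)
allLinkedFrom-sound (suc k) a p {b ∷ z} ok (s≤s |z|≤k) (ab ∷ linked) =
  allLinkedFrom-sound k b (λ z → p (a ∷ z))
    (⇒-elim (allΣ₅-sound next (proj₂ (∧-split (p (a ∷ [])) ok)) b) (dec-true (allowed? a b) ab)) |z|≤k linked
  where
  next : Σ₅ → Bool
  next b = not (does (allowed? a b)) ∨ allLinkedFrom k b (λ z → p (a ∷ z))

allLinked-sound : ∀ k p {z} → allLinked k p ≡ true → length z ≤ k → Linked Allowed z → p z ≡ true
allLinked-sound zero    p {[]}    ok _ _ = ok
allLinked-sound (suc k) p {[]}    ok _ _ = proj₁ (∧-split (p []) ok)
allLinked-sound (suc k) p {a ∷ z} ok (s≤s |z|≤k) linked =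
  allLinkedFrom-sound k a p (allΣ₅-sound (λ a → allLinkedFrom k a p) (proj₂ (∧-split (p []) ok)) a) |z|≤k linked

-- Walks through the suffixes with drop 1, so that each suffix is computed only once.
allDropsFrom : ℕ → ℕ → (ℕ → Word → Bool) → Word → Bool
allDropsFrom zero    i p t = true
allDropsFrom (suc n) i p t = p i t ∧ allDropsFrom n (suc i) p (drop 1 t)

allDropsFrom-sound : ∀ n i p t {d} → allDropsFrom n i p t ≡ true → d < n → p (i + d) (drop d t) ≡ true
allDropsFrom-sound (suc n) i p t {zero} ok _ =
  subst (λ k → p k t ≡ true) (sym (+-identityʳ i)) (proj₁ (∧-split (p i t) ok))
allDropsFrom-sound (suc n) i p t {suc d} ok (s≤s d<n) =
  subst₂ (λ k u → p k u ≡ true) (sym (+-suc i d)) (drop-drop 1 d t)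
    (allDropsFrom-sound n (suc i) p (drop 1 t) (proj₂ (∧-split (p i t) ok)) d<n)

allDrops : ℕ → (ℕ → Word → Bool) → Word → Bool
allDrops n = allDropsFrom n 0

allDrops-sound : ∀ n p t {d} → allDrops n p t ≡ true → d < n → p d (drop d t) ≡ true
allDrops-sound n = allDropsFrom-sound n 0

agree : ℕ → Word → Word → Bool
agree zero    _       _       = true
agree (suc n) (a ∷ s) (b ∷ t) = does (a ≟ b) ∧ agree n s t
agree (suc n) _       _       = false

agree-++ : ∀ x s t → agree (length x) (x ++ s) (x ++ t) ≡ true
agree-++ []      s t = refl
agree-++ (a ∷ x) s t = ∧-join (dec-true (a ≟ a) refl) (agree-++ x s t)

agree-square : ∀ x t → take (length x + length x) t ≡ x ++ x → agree (length x) t (drop (length x) t) ≡ true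
agree-square x t eq = subst (λ t → agree (length x) t (drop (length x) t) ≡ true) (sym t≡)
  (subst (λ u → agree (length x) (x ++ x ++ rest) u ≡ true) (sym (drop-length-++ x (x ++ rest))) (agree-++ x (x ++ rest) rest))
  where
  rest : Word
  rest = drop (length x + length x) t
  t≡ : t ≡ x ++ x ++ rest
  t≡ = trans (sym (take++drop≡id (length x + length x) t)) (trans (cong (_++ rest) eq) (++-assoc x x rest))

-- The checks below are closed equations b ≡ true proved by refl, which the type checker
-- decides by fast evaluation; a closed type T b would instead be re-evaluated slowly
-- whenever it is inspected, so the soundness lemmas above avoid T altogether.

spliced : ℕ → Σ₅ → Σ₅ → Σ₅ → Bool
spliced r b c e = does (drop r (hLetter b) ≟ʷ drop r (hLetter c)) ∧ does (take r (hLetter c) ≟ʷ take r (hLetter e))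

splice-trivial : ℕ → Σ₅ → Σ₅ → Σ₅ → Bool
splice-trivial r b c e = not (spliced r b c e) ∨ (does (b ≟ c) ∨ does (c ≟ e))

splices-trivial : ℕ → Bool
splices-trivial r = allΣ₅ λ b → allΣ₅ λ c → allΣ₅ (splice-trivial r b c)

splices-check : allBelow 24 splices-trivial ≡ true
splices-check = refl

h-spliceRigid : SpliceRigid
h-spliceRigid {r} {b} {c} {e} r<24 db≡dc tc≡te =
  Sum.map (does-sound (b ≟ c)) (does-sound (c ≟ e)) (∨-split (does (b ≟ c)) (⇒-elim {spliced r b c e} trivial isSpliced))
  where
  isSpliced : spliced r b c e ≡ true
  isSpliced = ∧-join (dec-true (drop r (hLetter b) ≟ʷ drop r (hLetter c)) db≡dc) (dec-true (take r (hLetter c) ≟ʷ take r (hLetter e)) tc≡te)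
  trivial : splice-trivial r b c e ≡ true
  trivial = allΣ₅-sound (splice-trivial r b c) (allΣ₅-sound (λ c → allΣ₅ (splice-trivial r b c))
              (allΣ₅-sound (λ b → allΣ₅ λ c → allΣ₅ (splice-trivial r b c)) (allBelow-sound 24 splices-trivial splices-check r<24) b) c) e

marker : Σ₅ → Σ₅ → Word
marker a a' = take 28 (h (a ∷ a' ∷ []))

marker-unaligned : Σ₅ → Σ₅ → ℕ → Word → Bool
marker-unaligned a a' j t = (j ≡ᵇ 0) ∨ not (does (take 28 t ≟ʷ marker a a'))

markers-unaligned-in : Σ₅ → Σ₅ → Word → Bool
markers-unaligned-in a a' z = allDrops 24 (marker-unaligned a a') (h z)

markers-unaligned : Σ₅ → Σ₅ → Bool
markers-unaligned a a' = not (does (allowed? a a')) ∨ allLinked 3 (markers-unaligned-in a a')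

markers-check : allΣ₅ (λ a → allΣ₅ (markers-unaligned a)) ≡ true
markers-check = refl

marker-not-at-offset : ∀ {a a' z j} → Allowed a a' → Linked Allowed z → length z ≤ 3 → 0 < j → j < 24 →
                       take 28 (drop j (h z)) ≢ marker a a'
marker-not-at-offset {a} {a'} {z} {suc j} aa' linked |z|≤3 _ j<24 =
  not-does-sound (take 28 (drop (suc j) (h z)) ≟ʷ marker a a')
    (allDrops-sound 24 (marker-unaligned a a') (h z) (allLinked-sound 3 (markers-unaligned-in a a') forPair |z|≤3 linked) j<24)
  where
  forPair : allLinked 3 (markers-unaligned-in a a') ≡ true
  forPair = ⇒-elim {does (allowed? a a')}
              (allΣ₅-sound (markers-unaligned a) (allΣ₅-sound (λ a → allΣ₅ (markers-unaligned a)) markers-check a) a')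
              (dec-true (allowed? a a') aa')

square-aligned : Word → ℕ → Word → Bool
square-aligned t p u = not (agree p t u) ∨ does (24 ∣? p)

squares-aligned-at : ℕ → Word → Bool
squares-aligned-at _ t = allDrops 52 (square-aligned t) t

squares-aligned-in : Word → Bool
squares-aligned-in z = allDrops 24 squares-aligned-at (h z)

squares-check : allLinked 6 squares-aligned-in ≡ true
squares-check = refl

short-square-period : ∀ {z r} x → Linked Allowed z → length z ≤ 6 → r < 24 → length x ≤ 51 →
                      take (length x + length x) (drop r (h z)) ≡ x ++ x → 24 ∣ length x
short-square-period {z} {r} x linked |z|≤6 r<24 |x|≤51 eq =
  does-sound (24 ∣? length x) (⇒-elim (allDrops-sound 52 (square-aligned t) t atR (s≤s |x|≤51)) (agree-square x t eq))
  where
  t : Word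
  t = drop r (h z)
  atR : squares-aligned-at r t ≡ true
  atR = allDrops-sound 24 squares-aligned-at (h z) (allLinked-sound 6 squares-aligned-in squares-check |z|≤6 linked) r<24

short-factor : Word → Bool
short-factor f = does (length f ≤? 3)

forbiddenOut-short : ∀ {f} → f ∈ forbiddenOut → length f ≤ 3
forbiddenOut-short {f} f∈ = does-sound (length f ≤? 3) (all-sound short-factor refl f∈)

factor-absent : Word → ℕ → Word → Bool
factor-absent f _ t = not (does (take (length f) t ≟ʷ f))

factor-absent-in : Word → Word → Bool
factor-absent-in f z = allDrops 24 (factor-absent f) (h z)

factor-absent-from-images : Word → Bool
factor-absent-from-images f = allLinked 2 (factor-absent-in f)

forbiddenOut-check : all factor-absent-from-images forbiddenOut ≡ true
forbiddenOut-check = refl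

forbiddenOut-not-at-offset : ∀ {f z r} → f ∈ forbiddenOut → Linked Allowed z → length z ≤ 2 → r < 24 →
                             take (length f) (drop r (h z)) ≢ f
forbiddenOut-not-at-offset {f} {z} {r} f∈ linked |z|≤2 r<24 =
  not-does-sound (take (length f) (drop r (h z)) ≟ʷ f)
    (allDrops-sound 24 (factor-absent f) (h z)
      (allLinked-sound 2 (factor-absent-in f) (all-sound factor-absent-from-images forbiddenOut-check f∈) |z|≤2 linked) r<24)

marker-aligned : ∀ {a a' y j} → Allowed a a' → Admissible y → j < 24 → take 28 (drop j (h y)) ≡ marker a a' → j ≡ 0
marker-aligned {j = zero}                  _   _   _    _  = refl
marker-aligned {a} {a'} {y} {suc j} aa' adm j<24 eq =
  ⊥-elim (marker-not-at-offset aa' (Admissible⇒Linked (Admissible-sub (take-isSubwordOf 3 y) adm)) (length-take-≤ 3 y) (s≤s z≤n) j<24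
            (trans (sym (take-drop-F 3 (suc j) 28 y (≤-trans (+-monoˡ-≤ 28 (<⇒≤ j<24)) (m≤m+n 52 20)))) eq))

long-square-length : ∀ {y r} x v → 51 < length x → drop r (h y) ≡ x ++ x ++ v → 3 ≤ length y
long-square-length {y} {r} x v 51<|x| eq = *-cancelʳ-≤ 3 (length y) 24 (begin
  72                   ≤⟨ m≤m+n 72 32 ⟩
  52 + 52              ≤⟨ +-mono-≤ 51<|x| 51<|x| ⟩
  length x + length x  ≤⟨ square-length {r = r} (h y) x v eq ⟩
  length (h y)         ≡⟨ length-F y ⟩
  length y * 24        ∎)
  where open ≤-Reasoning

long-square-period : ∀ y {r} x v → Admissible y → r < 24 → 51 < length x → drop r (h y) ≡ x ++ x ++ v →
                     3 ≤ length y → 24 ∣ length x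
long-square-period []           _ _ _ _ _ _ ()
long-square-period (_ ∷ [])     _ _ _ _ _ _ (s≤s ())
long-square-period (_ ∷ _ ∷ []) _ _ _ _ _ _ (s≤s (s≤s ()))
long-square-period y@(b ∷ a ∷ a' ∷ t) {r} x v adm r<24 51<|x| eq _ = ∣m+n∣m⇒∣n (m%n≡0⇒n∣m i 24 aligned) ∣-refl
  where
  i : ℕ
  i = 24 + length x
  periodic : take 28 (drop 24 (h y)) ≡ take 28 (drop i (h y))
  periodic = square⇒periodic (h y) x v eq (<⇒≤ r<24) (≤-trans 51<|x| (m≤n+m (length x) r))
  first : take 28 (drop 24 (h y)) ≡ marker a a'
  first = trans (cong (take 28) (drop-F 1 y)) (take-drop-F 2 0 28 (a ∷ a' ∷ t) (m≤m+n 28 20))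
  second : take 28 (drop (i % 24) (h (drop (i / 24) y))) ≡ marker a a'
  second = trans (cong (take 28) (sym (drop-F-mod i y))) (trans (sym periodic) first)
  aligned : i % 24 ≡ 0
  aligned = marker-aligned (adm (b ∷ [] , t , refl)) (Admissible-sub (drop-isSubwordOf (i / 24) y) adm) (m%n<n i 24) second

square-period-divisible : ∀ {y r} x v → Admissible y → r < 24 → drop r (h y) ≡ x ++ x ++ v → 24 ∣ length x
square-period-divisible {y} {r} x v adm r<24 eq with length x ≤? 51
... | no  |x|≰51 = long-square-period y x v adm r<24 (≰⇒> |x|≰51) eq (long-square-length {y} {r} x v (≰⇒> |x|≰51) eq)
... | yes |x|≤51 =
  short-square-period x (Admissible⇒Linked (Admissible-sub (take-isSubwordOf 6 y) adm)) (length-take-≤ 6 y) r<24 |x|≤51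
    (trans (sym (take-drop-F 6 r _ y fits)) (trans (cong (take _) eq) (take-square x v)))
  where
  fits : r + (length x + length x) ≤ 6 * 24
  fits = ≤-trans (+-mono-≤ (≤-pred r<24) (+-mono-≤ |x|≤51 |x|≤51)) (m≤m+n 125 19)

no-square-at-offset : ∀ {y r} x v → Admissible y → SquareFree y → r < 24 → x ≢ [] → drop r (h y) ≡ x ++ x ++ v → ⊥
no-square-at-offset []      v _   _  _    x≢[] _  = x≢[] refl
no-square-at-offset {y} {r} (c ∷ x) v adm sf r<24 _ eq with square-period-divisible (c ∷ x) v adm r<24 eq
... | divides (suc k) |x|≡ = HasSquare⇒¬SquareFree (square-of-multiple-period h-spliceRigid {r} {k} y (c ∷ x) v r<24 eq |x|≡) sf

no-forbidden-at-offset : ∀ {y r f} v → f ∈ forbiddenOut → Admissible y → r < 24 → drop r (h y) ≡ f ++ v → ⊥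
no-forbidden-at-offset {y} {r} {f} v f∈ adm r<24 eq =
  forbiddenOut-not-at-offset f∈ (Admissible⇒Linked (Admissible-sub (take-isSubwordOf 2 y) adm)) (length-take-≤ 2 y) r<24
    (trans (sym (take-drop-F 2 r (length f) y fits)) (trans (cong (take (length f)) eq) (take-length-++ f v)))
  where
  fits : r + length f ≤ 2 * 24
  fits = ≤-trans (+-mono-≤ (≤-pred r<24) (forbiddenOut-short f∈)) (m≤m+n 26 22)

theorem9 : (w : Word) → SquareFree w → AvoidsAll w forbiddenIn →
           SquareFree (h w) × AvoidsAll (h w) forbiddenOut
theorem9 w sf avoid = squareFree , AvoidsAll-intro forbiddenOut forbiddenFree
  where
  adm : Admissible w
  adm = admissible sf avoid
  squareFree : SquareFree (h w)
  squareFree _ (x , x≢[] , refl) (u , v , eq) =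
    no-square-at-offset x v (Admissible-sub suffix adm) (SquareFree-sub suffix sf) (m%n<n (length u) 24) x≢[]
      (trans (locate w u _ eq) (++-assoc x x v))
    where
    suffix : drop (length u / 24) w isSubwordOf w
    suffix = drop-isSubwordOf (length u / 24) w
  forbiddenFree : ∀ {f} → f ∈ forbiddenOut → ¬ f isSubwordOf h w
  forbiddenFree f∈ (u , v , eq) =
    no-forbidden-at-offset v f∈ (Admissible-sub (drop-isSubwordOf (length u / 24) w) adm) (m%n<n (length u) 24) (locate w u _ eq)
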